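{- Let $p,q$ be distinct primes $\ge3$, $m=pq$, $m'=\lfloor m/2\rfloor$. Let $\mathcal{H}_p,\mathcal{H}_q$, $C_k$, $C'_l$, $q^*$, $p^*$ be as in the context, with $1\in\mathcal{H}_p$ and $1\in\mathcal{H}_q$, and put $\mathcal{H}'_p=\mathcal{H}_p\setminus\{1\}$, $\mathcal{H}'_q=\mathcal{H}_q\setminus\{1\}$. For $k\in\mathcal{H}'_p$ and $l\in\mathcal{H}'_q$ define the linear forms (with the convention $Y_1=0$) $$R_{p,k}=\sum_{j\in C_k}Y_j-\sum_{j\in C_1}Y_j-Y_{(qk)_{red}}+Y_{(qq^*k)_{red}}-Y_{(qq^*)_{red}}+Y_q,$$ $$R_{q,l}=\sum_{j\in C'_l}Y_j-\sum_{j\in C'_1}Y_j-Y_{(pl)_{red}}+Y_{(pp^*l)_{red}}-Y_{(pp^*)_{red}}+Y_p.$$ Then the forms $R_{p,k}$, $k\in\mathcal{H}'_p$, together with the forms $R_{q,l}$, $l\in\mathcal{H}'_q$, are $\mathbb{Q}$-linearly independent (as elements of $\mathbb{Q}Y_2+\dots+\mathbb{Q}Y_{m'}$).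
   Context: For an integer $a\not\equiv0\pmod m$, $a_{red}$ is the unique integer in $\{1,\dots,m'\}$ with $a_{red}\equiv\pm a\pmod m$. $\mathcal{H}_p$ is a set of integers such that every $k\in\mathcal{H}_p$ satisfies $\gcd(k,q)=1$; for every $j\in\{1,\dots,(p-1)/2\}$ there is $k\in\mathcal{H}_p$ with $k\equiv j\pmod p$; and $k\not\equiv\pm k'\pmod p$ for distinct $k,k'\in\mathcal{H}_p$. $\mathcal{H}_q$ is defined symmetrically (elements coprime to $p$, representing each of $1,\dots,(q-1)/2$ modulo $q$, pairwise not congruent up to sign modulo $q$). For $k\in\mathcal{H}_p$, $C_k=\{(kj)_{red}: j\in\{1,\dots,m\},\ j\equiv1\pmod p,\ \gcd(j,q)=1\}$; for $l\in\mathcal{H}_q$, $C'_l=\{(lj)_{red}: j\in\{1,\dots,m\},\ j\equiv1\pmod q,\ \gcd(j,p)=1\}$. $q^*$ is a fixed integer with $qq^*\equiv1\pmod p$, and $p^*$ a fixed integer with $pp^*\equiv1\pmod q$. -}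

module Defs where

open import Data.Bool using (Bool; true; false; if_then_else_; _∧_; not)
open import Data.Nat as ℕ using (ℕ; zero; suc; _∸_; _≤ᵇ_; ⌊_/2⌋)
open import Data.Nat.GCD using (gcd)
open import Data.Nat.Divisibility using (_∣?_)
open import Data.Integer as ℤ using (ℤ; +_; _%ℕ_; ∣_∣)
open import Data.Integer.Divisibility using (_∣_)
open import Data.Rational as ℚ using (ℚ; 0ℚ; 1ℚ)
open import Data.List using (List; map; upTo; filterᵇ; foldr)
open import Data.Bool.ListAction using (any)
open import Data.List.Membership.Propositional using (_∈_)
open import Data.List.Relation.Unary.All using (All)
open import Data.List.Relation.Unary.AllPairs using (AllPairs)
open import Data.Product using (_×_; Σ)
open import Relation.Binary.PropositionalEquality using (_≡_)
open import Relation.Nullary using (¬_)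
open import Relation.Nullary.Decidable using (⌊_⌋)

-- a_red for modulus m: the unique element of {1..⌊m/2⌋} congruent to ±a mod m
-- (only meaningful for a ≢ 0 mod m; for a ≡ 0 it returns 0, an index outside 2..m').
red : ℕ → ℤ → ℕ
red zero    a = 0
red (suc n) a =
  if (a %ℕ suc n) ≤ᵇ ⌊ suc n /2⌋ then a %ℕ suc n else suc n ∸ (a %ℕ suc n)

_==_ : ℕ → ℕ → Bool
m == n = ⌊ m ℕ.≟ n ⌋

-- the j ∈ {1..m}, m = a*b, with j ≡ 1 (mod a) and gcd(j,b) = 1
-- (for j ≥ 1, j ≡ 1 mod a ⇔ a ∣ j - 1)
Jset : ℕ → ℕ → List ℕ
Jset a b = filterᵇ (λ j → ⌊ a ∣? (j ∸ 1) ⌋ ∧ (gcd j b == 1)) (map suc (upTo (a ℕ.* b)))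

-- membership of index i in C_k (for (a,b) = (p,q)) resp. C'_k (for (a,b) = (q,p)):
-- C_k = { (k j)_red : j ∈ Jset a b }, reduction modulo m = a*b
inC : ℕ → ℕ → ℤ → ℕ → Bool
inC a b k i = any (λ j → red (a ℕ.* b) (k ℤ.* + j) == i) (Jset a b)

𝟙 : Bool → ℚ
𝟙 true  = 1ℚ
𝟙 false = 0ℚ

δ : ℕ → ℕ → ℚ
δ x i = 𝟙 (x == i)

-- Coefficient of Y_i in the linear form
--  R_{a,k} = Σ_{j∈C_k} Y_j − Σ_{j∈C_1} Y_j − Y_{(bk)_red} + Y_{(b b* k)_red} − Y_{(b b*)_red} + Y_b
-- with (a,b,b*) = (p,q,q*) giving R_{p,k} and (q,p,p*) giving R_{q,l}.
Rform : ℕ → ℕ → ℤ → ℤ → ℕ → ℚ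
Rform a b bstar k i =
  𝟙 (inC a b k i) ℚ.- 𝟙 (inC a b (+ 1) i)
  ℚ.- δ (red m (+ b ℤ.* k)) i
  ℚ.+ δ (red m (+ b ℤ.* bstar ℤ.* k)) i
  ℚ.- δ (red m (+ b ℤ.* bstar)) i
  ℚ.+ δ b i
  where m = a ℕ.* b

Σℚ : List ℚ → ℚ
Σℚ = foldr ℚ._+_ 0ℚ

-- H is an admissible 𝓗_a relative to the other prime b (as in the context):
--  every k ∈ H has gcd(k,b) = 1;
--  every j ∈ {1..(a-1)/2} is ≡ some k ∈ H (mod a);
--  distinct members k,k' of H satisfy k ≢ ±k' (mod a)
--  (as AllPairs on the list; this also forces the list to be duplicate-free).
IsH : ℕ → ℕ → List ℤ → Set
IsH a b H =
  All (λ k → gcd ∣ k ∣ b ≡ 1) H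
  × ((j : ℕ) → 1 ℕ.≤ j → j ℕ.≤ ⌊ (a ∸ 1) /2⌋ → Σ ℤ (λ k → k ∈ H × (+ a ∣ (k ℤ.- + j))))
  × AllPairs (λ k k' → ¬ (+ a ∣ (k ℤ.- k')) × ¬ (+ a ∣ (k ℤ.+ k'))) H

remove1 : List ℤ → List ℤ
remove1 = filterᵇ (λ k → not ⌊ k ℤ.≟ + 1 ⌋)

{-# OPTIONS --safe #-}

-- Write C = Σₖ c_k and D = Σₗ d_l. The coefficient of Y_i in R_{a,k} ({a, b} = {p, q}) can be computed
-- at the indices we need: for b ∤ i it is [i ≡ ±k] − [i ≡ ±1] (mod a), since C_k consists of the i ≤ m′
-- with i ≡ ±k (mod a) and b ∤ i, while the four single terms vanish; at i = b it is
-- [k ≡ ±b] − [b ≡ ±1] + 1 (mod a). Evaluating the vanishing combination at indices found by the Chinese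
-- remainder theorem gives
--   at i ≡ ±k (mod a), i ≡ ±1 (mod b), for a ∤ k:  c_k − D = 0,
--   at i ≡ ±1 (mod a), i ≡ ∓1 (mod b):            −C − D = 0,
--   at i = a, for a ∣ k:  c_k = 0 if a ≡ ±1 (mod b), and otherwise c_k + D + d_l = 0 for the l ≡ ±a (mod b),
--                         where d_l = C by the first line with p and q exchanged.
-- So every c_k lies in {D, 0}, whence C = N·D with N ≥ 0, and C + D = 0 forces D = 0 = C.

module Submission where

open import Defs
open import Data.Nat using (ℕ; _≤_; ⌊_/2⌋; _*_)
open import Data.Nat.Primality using (Prime)
open import Data.Integer as ℤ using (ℤ; +_)
open import Data.Integer.Divisibility using (_∣_)
open import Data.Rational as ℚ using (ℚ; 0ℚ)
open import Data.List using (List; map)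
open import Data.List.Membership.Propositional using (_∈_)
open import Data.Product using (_×_)
open import Relation.Binary.PropositionalEquality using (_≡_; _≢_)

open import Data.Bool using (true; false; T)
open import Data.Bool.Properties using (T-∧; T?)
open import Data.Empty using (⊥-elim)
open import Data.Integer using (-[1+_]; ∣_∣; _%ℕ_; _/ℕ_)
import Data.Integer.DivMod as ℤ
open import Data.Integer.Divisibility.Signed as Signed using (∣ᵤ⇒∣; ∣⇒∣ᵤ) renaming (_∣_ to _∣ₛ_)
import Data.Integer.Properties as ℤₚ
open import Data.Integer.Tactic.RingSolver using (solve-∀)
open import Data.List using ([]; _∷_; upTo)
open import Data.List.Membership.Propositional using (find; lose)
open import Data.List.Membership.Propositional.Properties using (∈-filter⁺; ∈-filter⁻; ∈-map⁺; ∈-map⁻; ∈-upTo⁺)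
open import Data.List.Relation.Unary.All as All using (All)
open import Data.List.Relation.Unary.AllPairs as AllPairs using (AllPairs; []; _∷_)
open import Data.List.Relation.Unary.AllPairs.Properties using (filter⁺)
open import Data.List.Relation.Unary.Any using (here; there)
open import Data.List.Relation.Unary.Any.Properties using (any⁺; any⁻)
open import Data.Nat using (zero; suc; _<_; _∸_; _+_; z≤n; s≤s; _≤ᵇ_; NonZero)
import Data.Nat.Coprimality as ℕ
import Data.Nat.Divisibility as ℕ
open import Data.Nat.GCD using (gcd; gcd-greatest; gcd-zeroˡ; module Bézout)
import Data.Nat.Properties as ℕₚ
open import Data.Nat.Primality using (euclidsLemma; prime⇒irreducible; prime⇒nonZero)
open import Data.Product using (∃; _,_; proj₁; proj₂)
open import Data.Rational using (1ℚ)
import Data.Rational.Properties as ℚₚ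
open import Data.Rational.Solver using (module +-*-Solver)
open import Data.Sum using (_⊎_; inj₁; inj₂; [_,_]′)
open import Data.Unit using (tt)
open import Function using (_∘_; Equivalence)
open import Relation.Binary.PropositionalEquality using (refl; sym; trans; cong; cong₂; subst; module ≡-Reasoning)
open import Relation.Nullary using (¬_; Dec; yes; no)
open import Relation.Nullary.Decidable using (⌊_⌋; toWitness; fromWitness; toWitnessFalse; fromWitnessFalse)

-- Divisibility in ℤ
-- The lemmas use signed divisibility ∣ₛ, a record whose arguments Agda can infer; the unsigned ∣ of the
-- statement unfolds to divisibility of absolute values in ℕ.

∣-lincomb : ∀ {d x y} z u v → d ∣ₛ x → d ∣ₛ y → z ≡ u ℤ.* x ℤ.+ v ℤ.* y → d ∣ₛ z
∣-lincomb z u v d∣x d∣y z≡ =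
  subst (_ ∣ₛ_) (sym z≡) (Signed.∣m∣n⇒∣m+n (Signed.∣n⇒∣m*n u d∣x) (Signed.∣n⇒∣m*n v d∣y))

∣-multiple : ∀ {d x} z u → d ∣ₛ x → z ≡ u ℤ.* x → d ∣ₛ z
∣-multiple z u d∣x z≡ = subst (_ ∣ₛ_) (sym z≡) (Signed.∣n⇒∣m*n u d∣x)

∣-shift : ∀ {d} z x y → d ∣ₛ z ℤ.- x → d ∣ₛ z ℤ.- y → d ∣ₛ y ℤ.- x
∣-shift z x y d∣z-x d∣z-y = ∣-lincomb _ (+ 1) (ℤ.- + 1) d∣z-x d∣z-y (eq z x y)
  where eq : ∀ z x y → y ℤ.- x ≡ + 1 ℤ.* (z ℤ.- x) ℤ.+ ℤ.- + 1 ℤ.* (z ℤ.- y)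
        eq = solve-∀

n∣x-x%n : ∀ x n .{{_ : NonZero n}} → + n ∣ₛ x ℤ.- + (x %ℕ n)
n∣x-x%n x n = Signed.divides (x /ℕ n) (begin
  x ℤ.- r                    ≡⟨ cong (ℤ._- r) (ℤ.a≡a%ℕn+[a/ℕn]*n x n) ⟩
  r ℤ.+ x /ℕ n ℤ.* + n ℤ.- r  ≡⟨ eq r (x /ℕ n) (+ n) ⟩
  x /ℕ n ℤ.* + n             ∎)
  where
  open ≡-Reasoning
  r = + (x %ℕ n)
  eq : ∀ r q n → r ℤ.+ q ℤ.* n ℤ.- r ≡ q ℤ.* n
  eq = solve-∀

*-cancel-∣ : ∀ a b .{{_ : NonZero b}} {y} → + (a * b) ∣ₛ + b ℤ.* y → + a ∣ₛ y
*-cancel-∣ a b ab∣by =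
  Signed.*-cancelˡ-∣ (+ b) (subst (_∣ₛ + b ℤ.* _) (trans (ℤₚ.pos-* a b) (ℤₚ.*-comm (+ a) (+ b))) ab∣by)

*-mono-∣ : ∀ a b {y} → + a ∣ₛ y → + (a * b) ∣ₛ + b ℤ.* y
*-mono-∣ a b a∣y =
  subst (_∣ₛ + b ℤ.* _) (sym (trans (ℤₚ.pos-* a b) (ℤₚ.*-comm (+ a) (+ b)))) (Signed.*-monoʳ-∣ (+ b) a∣y)

coprime-∣-∧-∣⇒*-∣ : ∀ {a b x} → ℕ.Coprime a b → + a ∣ₛ x → + b ∣ₛ x → + (a * b) ∣ₛ x
coprime-∣-∧-∣⇒*-∣ {a} {b} coprime a∣x b∣x with ∣⇒∣ᵤ a∣x
... | ℕ.divides t ∣x∣≡t*a = ∣ᵤ⇒∣ (subst (_ ℕ.∣_) (sym ∣x∣≡a*t)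
  (ℕ.*-monoʳ-∣ a (ℕ.coprime-divisor (ℕ.sym coprime) (subst (b ℕ.∣_) ∣x∣≡a*t (∣⇒∣ᵤ b∣x)))))
  where ∣x∣≡a*t = trans ∣x∣≡t*a (ℕₚ.*-comm t a)

∃-inverse-mod : ∀ {n} k → gcd ∣ k ∣ n ≡ 1 → ∃ λ u → + n ∣ₛ u ℤ.* k ℤ.- + 1
∃-inverse-mod {n} k gcd≡1 = unsign k (inverse-of-∣k∣ (ℕ.coprime-Bézout (ℕ.gcd≡1⇒coprime gcd≡1)))
  where
  unsign : ∀ k → ∃ (λ u → + n ∣ₛ u ℤ.* + ∣ k ∣ ℤ.- + 1) → ∃ λ u → + n ∣ₛ u ℤ.* k ℤ.- + 1
  unsign (+ _)     inverse      = inverse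
  unsign -[1+ m ] (u , n∣u∣k∣-1) = ℤ.- u , subst (_ ∣ₛ_) (eq u (+ suc m)) n∣u∣k∣-1
    where eq : ∀ u k → u ℤ.* k ℤ.- + 1 ≡ ℤ.- u ℤ.* ℤ.- k ℤ.- + 1
          eq = solve-∀
  inverse-of-∣k∣ : Bézout.Identity 1 ∣ k ∣ n → ∃ λ u → + n ∣ₛ u ℤ.* + ∣ k ∣ ℤ.- + 1
  inverse-of-∣k∣ (Bézout.+- x y 1+yn≡x∣k∣) = + x , Signed.divides (+ y) (begin
    + x ℤ.* + ∣ k ∣ ℤ.- + 1
      ≡⟨ cong (ℤ._- + 1) (trans (sym (ℤₚ.pos-* x ∣ k ∣)) (cong +_ (sym 1+yn≡x∣k∣))) ⟩
    + (1 + y * n) ℤ.- + 1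
      ≡⟨ cong (ℤ._- + 1) (trans (ℤₚ.pos-+ 1 (y * n)) (cong (ℤ._+_ (+ 1)) (ℤₚ.pos-* y n))) ⟩
    + 1 ℤ.+ + y ℤ.* + n ℤ.- + 1
      ≡⟨ eq (+ y) (+ n) ⟩
    + y ℤ.* + n ∎)
    where
    open ≡-Reasoning
    eq : ∀ y n → + 1 ℤ.+ y ℤ.* n ℤ.- + 1 ≡ y ℤ.* n
    eq = solve-∀
  inverse-of-∣k∣ (Bézout.-+ x y 1+x∣k∣≡yn) = ℤ.- + x , Signed.divides (ℤ.- + y) (begin
    ℤ.- + x ℤ.* + ∣ k ∣ ℤ.- + 1       ≡⟨ eq (+ x) (+ ∣ k ∣) ⟩
    ℤ.- (+ 1 ℤ.+ + x ℤ.* + ∣ k ∣)     ≡⟨ cong (ℤ.-_ ∘ (ℤ._+_ (+ 1))) (sym (ℤₚ.pos-* x ∣ k ∣)) ⟩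
    ℤ.- + (1 + x * ∣ k ∣)            ≡⟨ cong (ℤ.-_ ∘ +_) 1+x∣k∣≡yn ⟩
    ℤ.- + (y * n)                   ≡⟨ cong ℤ.-_ (ℤₚ.pos-* y n) ⟩
    ℤ.- (+ y ℤ.* + n)                ≡⟨ ℤₚ.neg-distribˡ-* (+ y) (+ n) ⟩
    ℤ.- + y ℤ.* + n                  ∎)
    where
    open ≡-Reasoning
    eq : ∀ x k → ℤ.- x ℤ.* k ℤ.- + 1 ≡ ℤ.- (+ 1 ℤ.+ x ℤ.* k)
    eq = solve-∀

-- Primes

prime⇒2≤ : ∀ {p} → Prime p → 2 ≤ p
prime⇒2≤ {suc (suc _)} _ = s≤s (s≤s z≤n)

2≤⇒∤1 : ∀ {n} → 2 ≤ n → ¬ + n ∣ₛ + 1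
2≤⇒∤1 2≤n n∣1 with ℕ.∣1⇒≡1 (∣⇒∣ᵤ n∣1)
2≤⇒∤1 (s≤s ()) n∣1 | refl

3≤⇒∤2 : ∀ {n} → 3 ≤ n → ¬ + n ∣ₛ + 2
3≤⇒∤2 3≤n n∣2 = ℕₚ.<⇒≱ 3≤n (ℕ.∣⇒≤ (∣⇒∣ᵤ n∣2))

prime∤prime : ∀ {p q} → Prime p → Prime q → p ≢ q → ¬ + q ∣ₛ + p
prime∤prime p-prime q-prime p≢q q∣p with prime⇒irreducible p-prime (∣⇒∣ᵤ q∣p)
... | inj₁ refl = ℕₚ.<⇒≢ (prime⇒2≤ q-prime) refl
... | inj₂ q≡p  = p≢q (sym q≡p)

distinct-primes-coprime : ∀ {p q} → Prime p → Prime q → p ≢ q → ℕ.Coprime p q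
distinct-primes-coprime {p} {q} p-prime q-prime p≢q {d} (d∣p , d∣q)
  with prime⇒irreducible p-prime d∣p
... | inj₁ d≡1 = d≡1
... | inj₂ refl = ⊥-elim (prime∤prime q-prime p-prime (p≢q ∘ sym) (∣ᵤ⇒∣ d∣q))

prime∤⇒gcd≡1 : ∀ {p n} → Prime p → ¬ p ℕ.∣ n → gcd n p ≡ 1
prime∤⇒gcd≡1 p-prime p∤n = ℕ.coprime⇒gcd≡1 (ℕ.sym coprime)
  where
  coprime : ℕ.Coprime _ _
  coprime (d∣p , d∣n) with prime⇒irreducible p-prime d∣p
  ... | inj₁ d≡1 = d≡1
  ... | inj₂ refl = ⊥-elim (p∤n d∣n)

gcd≡1⇒∤ : ∀ {n} k → 2 ≤ n → gcd ∣ k ∣ n ≡ 1 → ¬ + n ∣ₛ k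
gcd≡1⇒∤ k 2≤n gcd≡1 n∣k =
  2≤⇒∤1 2≤n (∣ᵤ⇒∣ (subst (_ ℕ.∣_) gcd≡1 (gcd-greatest (∣⇒∣ᵤ n∣k) ℕ.∣-refl)))

prime-∣-* : ∀ {p} → Prime p → ∀ x y → + p ∣ₛ x ℤ.* y → + p ∣ₛ x ⊎ + p ∣ₛ y
prime-∣-* p-prime x y p∣xy
  with euclidsLemma ∣ x ∣ ∣ y ∣ p-prime (subst (_ ℕ.∣_) (ℤₚ.abs-* x y) (∣⇒∣ᵤ p∣xy))
... | inj₁ p∣x = inj₁ (∣ᵤ⇒∣ p∣x)
... | inj₂ p∣y = inj₂ (∣ᵤ⇒∣ p∣y)

odd-prime : ∀ {p} → Prime p → 3 ≤ p → ¬ 2 ℕ.∣ p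
odd-prime p-prime 3≤p 2∣p with prime⇒irreducible p-prime 2∣p
... | inj₂ refl = ℕₚ.<⇒≱ 3≤p ℕₚ.≤-refl

-- Congruence up to sign

infix 4 _≡±_mod_ _≡±?_mod_

data _≡±_mod_ (x y : ℤ) (n : ℕ) : Set where
  plus  : + n ∣ₛ x ℤ.- y → x ≡± y mod n
  minus : + n ∣ₛ x ℤ.+ y → x ≡± y mod n

≡±-refl : ∀ {n} x → x ≡± x mod n
≡±-refl x = plus (Signed.divides (+ 0) (ℤₚ.+-inverseʳ x))

≡±-neg : ∀ {n} x → ℤ.- x ≡± x mod n
≡±-neg x = minus (Signed.divides (+ 0) (ℤₚ.+-inverseˡ x))

≡±-sym : ∀ {n x y} → x ≡± y mod n → y ≡± x mod n
≡±-sym {x = x} {y} (plus d)  = plus (∣-multiple _ (ℤ.- + 1) d (eq x y))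
  where eq : ∀ x y → y ℤ.- x ≡ ℤ.- + 1 ℤ.* (x ℤ.- y)
        eq = solve-∀
≡±-sym {x = x} {y} (minus d) = minus (∣-multiple _ (+ 1) d (eq x y))
  where eq : ∀ x y → y ℤ.+ x ≡ + 1 ℤ.* (x ℤ.+ y)
        eq = solve-∀

≡±-trans : ∀ {n x y z} → x ≡± y mod n → y ≡± z mod n → x ≡± z mod n
≡±-trans {x = x} {y} {z} (plus d) (plus d′) = plus (∣-lincomb _ (+ 1) (+ 1) d d′ (eq x y z))
  where eq : ∀ x y z → x ℤ.- z ≡ + 1 ℤ.* (x ℤ.- y) ℤ.+ + 1 ℤ.* (y ℤ.- z)
        eq = solve-∀
≡±-trans {x = x} {y} {z} (plus d) (minus d′) = minus (∣-lincomb _ (+ 1) (+ 1) d d′ (eq x y z))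
  where eq : ∀ x y z → x ℤ.+ z ≡ + 1 ℤ.* (x ℤ.- y) ℤ.+ + 1 ℤ.* (y ℤ.+ z)
        eq = solve-∀
≡±-trans {x = x} {y} {z} (minus d) (plus d′) = minus (∣-lincomb _ (+ 1) (ℤ.- + 1) d d′ (eq x y z))
  where eq : ∀ x y z → x ℤ.+ z ≡ + 1 ℤ.* (x ℤ.+ y) ℤ.+ ℤ.- + 1 ℤ.* (y ℤ.- z)
        eq = solve-∀
≡±-trans {x = x} {y} {z} (minus d) (minus d′) = plus (∣-lincomb _ (+ 1) (ℤ.- + 1) d d′ (eq x y z))
  where eq : ∀ x y z → x ℤ.- z ≡ + 1 ℤ.* (x ℤ.+ y) ℤ.+ ℤ.- + 1 ℤ.* (y ℤ.+ z)
        eq = solve-∀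

≡±-*ˡ : ∀ {n x y} c → x ≡± y mod n → c ℤ.* x ≡± c ℤ.* y mod n
≡±-*ˡ {x = x} {y} c (plus d)  = plus (∣-multiple _ c d (eq c x y))
  where eq : ∀ c x y → c ℤ.* x ℤ.- c ℤ.* y ≡ c ℤ.* (x ℤ.- y)
        eq = solve-∀
≡±-*ˡ {x = x} {y} c (minus d) = minus (∣-multiple _ c d (eq c x y))
  where eq : ∀ c x y → c ℤ.* x ℤ.+ c ℤ.* y ≡ c ℤ.* (x ℤ.+ y)
        eq = solve-∀

≡±-∣ : ∀ {d n x y} → d ℕ.∣ n → x ≡± y mod n → x ≡± y mod d
≡±-∣ d∣n (plus n∣)  = plus (Signed.∣-trans (∣ᵤ⇒∣ d∣n) n∣)
≡±-∣ d∣n (minus n∣) = minus (Signed.∣-trans (∣ᵤ⇒∣ d∣n) n∣)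

≡±0⇒∣ : ∀ {n x} → x ≡± + 0 mod n → + n ∣ₛ x
≡±0⇒∣ {x = x} (plus d)  = subst (_ ∣ₛ_) (ℤₚ.+-identityʳ x) d
≡±0⇒∣ {x = x} (minus d) = subst (_ ∣ₛ_) (ℤₚ.+-identityʳ x) d

∣⇒≡±0 : ∀ {n x} → + n ∣ₛ x → x ≡± + 0 mod n
∣⇒≡±0 {x = x} d = plus (subst (_ ∣ₛ_) (sym (ℤₚ.+-identityʳ x)) d)

≡±-resp-∣ : ∀ {n x y} → x ≡± y mod n → + n ∣ₛ x → + n ∣ₛ y
≡±-resp-∣ x≡±y n∣x = ≡±0⇒∣ (≡±-trans (≡±-sym x≡±y) (∣⇒≡±0 n∣x))

_≡±?_mod_ : ∀ x y n → Dec (x ≡± y mod n)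
x ≡±? y mod n with + n Signed.∣? x ℤ.- y | + n Signed.∣? x ℤ.+ y
... | yes d | _      = yes (plus d)
... | no _  | yes d  = yes (minus d)
... | no ¬d | no ¬d′ = no λ { (plus d) → ¬d d ; (minus d) → ¬d′ d }

≡±-*-cancel : ∀ a b .{{_ : NonZero b}} {y z} → + b ℤ.* y ≡± + b ℤ.* z mod (a * b) → y ≡± z mod a
≡±-*-cancel a b {y} {z} (plus d)  = plus (*-cancel-∣ a b (subst (_ ∣ₛ_) (eq (+ b) y z) d))
  where eq : ∀ b y z → b ℤ.* y ℤ.- b ℤ.* z ≡ b ℤ.* (y ℤ.- z)
        eq = solve-∀
≡±-*-cancel a b {y} {z} (minus d) = minus (*-cancel-∣ a b (subst (_ ∣ₛ_) (eq (+ b) y z) d))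
  where eq : ∀ b y z → b ℤ.* y ℤ.+ b ℤ.* z ≡ b ℤ.* (y ℤ.+ z)
        eq = solve-∀

≡±-*-mono : ∀ a b {y z} → y ≡± z mod a → + b ℤ.* y ≡± + b ℤ.* z mod (a * b)
≡±-*-mono a b {y} {z} (plus d)  = plus (subst (_ ∣ₛ_) (eq (+ b) y z) (*-mono-∣ a b d))
  where eq : ∀ b y z → b ℤ.* (y ℤ.- z) ≡ b ℤ.* y ℤ.- b ℤ.* z
        eq = solve-∀
≡±-*-mono a b {y} {z} (minus d) = minus (subst (_ ∣ₛ_) (eq (+ b) y z) (*-mono-∣ a b d))
  where eq : ∀ b y z → b ℤ.* (y ℤ.+ z) ≡ b ℤ.* y ℤ.+ b ℤ.* z
        eq = solve-∀

-- Halving and the reduction red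

≢0∧≢1⇒2≤ : ∀ {n} → n ≢ 0 → n ≢ 1 → 2 ≤ n
≢0∧≢1⇒2≤ {zero}          n≢0 _   = ⊥-elim (n≢0 refl)
≢0∧≢1⇒2≤ {suc zero}      _   n≢1 = ⊥-elim (n≢1 refl)
≢0∧≢1⇒2≤ {suc (suc _)}   _   _   = s≤s (s≤s z≤n)

⌈n/2⌉≤1+⌊n/2⌋ : ∀ n → ⌊ suc n /2⌋ ≤ suc ⌊ n /2⌋
⌈n/2⌉≤1+⌊n/2⌋ zero          = z≤n
⌈n/2⌉≤1+⌊n/2⌋ (suc zero)    = s≤s z≤n
⌈n/2⌉≤1+⌊n/2⌋ (suc (suc n)) = s≤s (⌈n/2⌉≤1+⌊n/2⌋ n)

⌊n/2⌋+⌊n/2⌋≤n : ∀ n → ⌊ n /2⌋ + ⌊ n /2⌋ ≤ n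
⌊n/2⌋+⌊n/2⌋≤n n =
  ℕₚ.≤-trans (ℕₚ.+-monoʳ-≤ ⌊ n /2⌋ (ℕₚ.⌊n/2⌋≤⌈n/2⌉ n)) (ℕₚ.≤-reflexive (ℕₚ.⌊n/2⌋+⌈n/2⌉≡n n))

odd⇒⌊n/2⌋≤⌊n∸1/2⌋ : ∀ n → ¬ 2 ℕ.∣ n → ⌊ n /2⌋ ≤ ⌊ n ∸ 1 /2⌋
odd⇒⌊n/2⌋≤⌊n∸1/2⌋ zero                2∤n = ⊥-elim (2∤n (ℕ._∣0 2))
odd⇒⌊n/2⌋≤⌊n∸1/2⌋ (suc zero)          _   = z≤n
odd⇒⌊n/2⌋≤⌊n∸1/2⌋ (suc (suc zero))    2∤n = ⊥-elim (2∤n ℕ.∣-refl)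
odd⇒⌊n/2⌋≤⌊n∸1/2⌋ (suc (suc (suc n))) 2∤n =
  s≤s (odd⇒⌊n/2⌋≤⌊n∸1/2⌋ (suc n) (2∤n ∘ ℕ.∣m∣n⇒∣m+n ℕ.∣-refl))

∣∧<⇒≡0 : ∀ {M t} → M ℕ.∣ t → t < M → t ≡ 0
∣∧<⇒≡0 {t = zero}  _   _   = refl
∣∧<⇒≡0 {t = suc t} M∣t t<M = ⊥-elim (ℕₚ.<⇒≱ t<M (ℕ.∣⇒≤ M∣t))

≡±-on-half⇒≡ : ∀ {n i j} → i ≤ ⌊ suc n /2⌋ → j ≤ ⌊ suc n /2⌋ → + i ≡± + j mod suc n → i ≡ j
≡±-on-half⇒≡ {n} {i} {j} i≤h j≤h i≡±j =
  [ (λ i≤j → ordered i≤j j≤h i≡±j) , (λ j≤i → sym (ordered j≤i i≤h (≡±-sym i≡±j))) ]′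
    (ℕₚ.≤-total i j)
  where
  M = suc n
  h = ⌊ M /2⌋
  ordered : ∀ {i j} → i ≤ j → j ≤ h → + i ≡± + j mod M → i ≡ j
  ordered {i} {j} i≤j j≤h (plus M∣i-j) = ℕₚ.≤-antisym i≤j (ℕₚ.m∸n≡0⇒m≤n (∣∧<⇒≡0 M∣j∸i j∸i<M))
    where
    M∣j∸i : M ℕ.∣ j ∸ i
    M∣j∸i = subst (M ℕ.∣_) (trans (cong ∣_∣ (ℤₚ.m-n≡m⊖n i j)) (ℤₚ.∣⊖∣-≤ i≤j)) (∣⇒∣ᵤ M∣i-j)
    j∸i<M : j ∸ i < M
    j∸i<M = ℕₚ.≤-<-trans (ℕₚ.≤-trans (ℕₚ.m∸n≤m j i) j≤h) (ℕₚ.⌊n/2⌋<n n)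
  ordered {i} {j} i≤j j≤h (minus M∣i+j) =
    [ both-zero , both-half ]′ (ℕₚ.m≤n⇒m<n∨m≡n i+j≤M)
    where
    i+j≤M : i + j ≤ M
    i+j≤M = ℕₚ.≤-trans (ℕₚ.+-mono-≤ (ℕₚ.≤-trans i≤j j≤h) j≤h) (⌊n/2⌋+⌊n/2⌋≤n M)
    both-zero : i + j < M → i ≡ j
    both-zero i+j<M = trans (ℕₚ.m+n≡0⇒m≡0 i i+j≡0) (sym (ℕₚ.m+n≡0⇒n≡0 i i+j≡0))
      where i+j≡0 = ∣∧<⇒≡0 (subst (M ℕ.∣_) (cong ∣_∣ (sym (ℤₚ.pos-+ i j))) (∣⇒∣ᵤ M∣i+j)) i+j<M
    both-half : i + j ≡ M → i ≡ j
    both-half i+j≡M = ℕₚ.≤-antisym i≤j (ℕₚ.≤-trans j≤h (ℕₚ.+-cancelʳ-≤ h h i (begin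
      h + h  ≤⟨ ⌊n/2⌋+⌊n/2⌋≤n M ⟩
      M      ≡⟨ i+j≡M ⟨
      i + j  ≤⟨ ℕₚ.+-monoʳ-≤ i j≤h ⟩
      i + h  ∎)))
      where open ℕₚ.≤-Reasoning

red≤⌊/2⌋ : ∀ M X → red M X ≤ ⌊ M /2⌋
red≤⌊/2⌋ zero    X = z≤n
red≤⌊/2⌋ (suc n) X with (X %ℕ suc n) ≤ᵇ ⌊ suc n /2⌋ in r≤ᵇh
... | true  = ℕₚ.≤ᵇ⇒≤ _ _ (subst T (sym r≤ᵇh) tt)
... | false = ℕₚ.m≤n+o⇒m∸n≤o M r (begin
    M                 ≡⟨ ℕₚ.⌊n/2⌋+⌈n/2⌉≡n M ⟨
    h + ⌊ suc M /2⌋   ≤⟨ ℕₚ.+-monoʳ-≤ h (ℕₚ.≤-trans (⌈n/2⌉≤1+⌊n/2⌋ M) h<r) ⟩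
    h + r             ≡⟨ ℕₚ.+-comm h r ⟩
    r + h             ∎)
  where
  open ℕₚ.≤-Reasoning
  M = suc n
  r = X %ℕ M
  h = ⌊ M /2⌋
  h<r : h < r
  h<r = ℕₚ.≰⇒> (λ r≤h → subst T r≤ᵇh (ℕₚ.≤⇒≤ᵇ r≤h))

red-≡± : ∀ M .{{_ : NonZero M}} X → X ≡± + red M X mod M
red-≡± (suc n) X with (X %ℕ suc n) ≤ᵇ ⌊ suc n /2⌋
... | true  = plus (n∣x-x%n X (suc n))
... | false = minus (∣-lincomb _ (+ 1) (+ 1) (n∣x-x%n X M) Signed.∣-refl (begin
    X ℤ.+ + (M ∸ X %ℕ M)         ≡⟨ cong (ℤ._+_ X) M∸r≡M-r ⟩
    X ℤ.+ (+ M ℤ.- r)            ≡⟨ eq X r (+ M) ⟩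
    + 1 ℤ.* (X ℤ.- r) ℤ.+ + 1 ℤ.* + M  ∎))
  where
  open ≡-Reasoning
  M = suc n
  r = + (X %ℕ M)
  M∸r≡M-r : + (M ∸ X %ℕ M) ≡ + M ℤ.- r
  M∸r≡M-r = sym (trans (ℤₚ.m-n≡m⊖n M (X %ℕ M)) (ℤₚ.⊖-≥ (ℕₚ.<⇒≤ (ℤ.n%ℕd<d X M))))
  eq : ∀ X r M → X ℤ.+ (M ℤ.- r) ≡ + 1 ℤ.* (X ℤ.- r) ℤ.+ + 1 ℤ.* M
  eq = solve-∀

red-unique : ∀ M .{{_ : NonZero M}} X {i} → i ≤ ⌊ M /2⌋ → X ≡± + i mod M → red M X ≡ i
red-unique (suc n) X i≤h X≡±i =
  ≡±-on-half⇒≡ (red≤⌊/2⌋ (suc n) X) i≤h (≡±-trans (≡±-sym (red-≡± (suc n) X)) X≡±i)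

∈-remove1⁻ : ∀ {H k} → k ∈ remove1 H → k ∈ H × k ≢ + 1
∈-remove1⁻ k∈H′ with ∈-filter⁻ (T? ∘ _) k∈H′
... | k∈H , k≢1 = k∈H , toWitnessFalse k≢1

∈-remove1⁺ : ∀ {H k} → k ∈ H → k ≢ + 1 → k ∈ remove1 H
∈-remove1⁺ k∈H k≢1 = ∈-filter⁺ (T? ∘ _) k∈H (fromWitnessFalse k≢1)

allPairs-lookup : ∀ {A : Set} {R : A → A → Set} {xs x y} → (∀ {u v} → R u v → R v u) →
  AllPairs R xs → x ∈ xs → y ∈ xs → x ≢ y → R x y
allPairs-lookup R-sym (_   ∷ _)   (here refl) (here refl) x≢y = ⊥-elim (x≢y refl)
allPairs-lookup R-sym (Rx ∷ _)   (here refl) (there y∈)  _   = All.lookup Rx y∈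
allPairs-lookup R-sym (Ry ∷ _)   (there x∈)  (here refl) _   = R-sym (All.lookup Ry x∈)
allPairs-lookup R-sym (_   ∷ Rxs) (there x∈)  (there y∈)  x≢y = allPairs-lookup R-sym Rxs x∈ y∈ x≢y

T⇔⇒≡⌊⌋ : ∀ {P : Set} {b} (P? : Dec P) → (T b → P) → (P → T b) → b ≡ ⌊ P? ⌋
T⇔⇒≡⌊⌋ {b = true}  (yes _)  _  _    = refl
T⇔⇒≡⌊⌋ {b = true}  (no ¬p) to _    = ⊥-elim (¬p (to tt))
T⇔⇒≡⌊⌋ {b = false} (yes p) _  from = ⊥-elim (from p)
T⇔⇒≡⌊⌋ {b = false} (no _)  _  _    = refl

⌊⌋-⇔ : ∀ {P Q : Set} (P? : Dec P) (Q? : Dec Q) → (P → Q) → (Q → P) → ⌊ P? ⌋ ≡ ⌊ Q? ⌋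
⌊⌋-⇔ P? Q? to from = T⇔⇒≡⌊⌋ Q? (to ∘ toWitness) (fromWitness ∘ from)

𝟙-yes : ∀ {P : Set} (P? : Dec P) → P → 𝟙 ⌊ P? ⌋ ≡ 1ℚ
𝟙-yes (yes _) _  = refl
𝟙-yes (no ¬p) p = ⊥-elim (¬p p)

𝟙-no : ∀ {P : Set} (P? : Dec P) → ¬ P → 𝟙 ⌊ P? ⌋ ≡ 0ℚ
𝟙-no (yes p) ¬p = ⊥-elim (¬p p)
𝟙-no (no _)  _  = refl

module _ {A : Set} where
  open +-*-Solver

  Σℚ-*-const : ∀ (c v : A → ℚ) w xs → (∀ x → x ∈ xs → v x ≡ w) →
    Σℚ (map (λ x → c x ℚ.* v x) xs) ≡ Σℚ (map c xs) ℚ.* w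
  Σℚ-*-const c v w []       _   = sym (ℚₚ.*-zeroˡ w)
  Σℚ-*-const c v w (x ∷ xs) v≡w =
    trans (cong₂ (λ vx s → c x ℚ.* vx ℚ.+ s) (v≡w x (here refl)) (Σℚ-*-const c v w xs (λ y → v≡w y ∘ there)))
          (sym (ℚₚ.*-distribʳ-+ w (c x) (Σℚ (map c xs))))

  Σℚ-*-indicator : ∀ {P : A → Set} (P? : ∀ x → Dec (P x)) (c v : A → ℚ) w {xs} →
    AllPairs (λ x y → ¬ (P x × P y)) xs → (∀ x → x ∈ xs → v x ≡ w ℚ.+ 𝟙 ⌊ P? x ⌋) →
    ∀ {k} → k ∈ xs → P k → Σℚ (map (λ x → c x ℚ.* v x) xs) ≡ Σℚ (map c xs) ℚ.* w ℚ.+ c k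
  Σℚ-*-indicator P? c v w {x ∷ xs} (¬Pxy ∷ _) v≡ (here refl) Px = begin
    c x ℚ.* v x ℚ.+ Σℚ (map (λ y → c y ℚ.* v y) xs)
      ≡⟨ cong₂ (λ vx s → c x ℚ.* vx ℚ.+ s) vx≡w+1 (Σℚ-*-const c v w xs vy≡w) ⟩
    c x ℚ.* (w ℚ.+ 1ℚ) ℚ.+ Σℚ (map c xs) ℚ.* w
      ≡⟨ solve 3 (λ a s w → a :* (w :+ con 1ℚ) :+ s :* w := (a :+ s) :* w :+ a) refl (c x) (Σℚ (map c xs)) w ⟩
    (c x ℚ.+ Σℚ (map c xs)) ℚ.* w ℚ.+ c x
      ∎
    where
    open ≡-Reasoning
    vx≡w+1 : v x ≡ w ℚ.+ 1ℚ
    vx≡w+1 = trans (v≡ x (here refl)) (cong (w ℚ.+_) (𝟙-yes (P? x) Px))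
    vy≡w : ∀ y → y ∈ xs → v y ≡ w
    vy≡w y y∈ = trans (v≡ y (there y∈))
      (trans (cong (w ℚ.+_) (𝟙-no (P? y) (λ Py → All.lookup ¬Pxy y∈ (Px , Py)))) (ℚₚ.+-identityʳ w))
  Σℚ-*-indicator P? c v w {x ∷ xs} (¬Pxy ∷ pairs) v≡ {k} (there k∈) Pk = begin
    c x ℚ.* v x ℚ.+ Σℚ (map (λ y → c y ℚ.* v y) xs)
      ≡⟨ cong₂ (λ vx s → c x ℚ.* vx ℚ.+ s) vx≡w (Σℚ-*-indicator P? c v w pairs (λ y → v≡ y ∘ there) k∈ Pk) ⟩
    c x ℚ.* w ℚ.+ (Σℚ (map c xs) ℚ.* w ℚ.+ c k)
      ≡⟨ solve 4 (λ a s w ck → a :* w :+ (s :* w :+ ck) := (a :+ s) :* w :+ ck) refl (c x) (Σℚ (map c xs)) w (c k) ⟩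
    (c x ℚ.+ Σℚ (map c xs)) ℚ.* w ℚ.+ c k
      ∎
    where
    open ≡-Reasoning
    vx≡w : v x ≡ w
    vx≡w = trans (v≡ x (here refl))
      (trans (cong (w ℚ.+_) (𝟙-no (P? x) (λ Px → All.lookup ¬Pxy k∈ (Px , Pk)))) (ℚₚ.+-identityʳ w))

  Σℚ-two-valued : ∀ (c : A → ℚ) D xs → (∀ x → x ∈ xs → c x ≡ D ⊎ c x ≡ 0ℚ) →
    ∃ λ N → ℚ.NonNegative N × Σℚ (map c xs) ≡ N ℚ.* D
  Σℚ-two-valued c D []       _    = 0ℚ , _ , sym (ℚₚ.*-zeroˡ D)
  Σℚ-two-valued c D (x ∷ xs) c∈ with Σℚ-two-valued c D xs (λ y → c∈ y ∘ there) | c∈ x (here refl)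
  ... | N , N≥0 , Σ≡N*D | inj₁ cx≡D = 1ℚ ℚ.+ N , ℚₚ.nonNeg+nonNeg⇒nonNeg 1ℚ N {{N≥0}} ,
    trans (cong₂ ℚ._+_ cx≡D Σ≡N*D) (solve 2 (λ d n → d :+ n :* d := (con 1ℚ :+ n) :* d) refl D N)
  ... | N , N≥0 , Σ≡N*D | inj₂ cx≡0 = N , N≥0 , trans (cong₂ ℚ._+_ cx≡0 Σ≡N*D) (ℚₚ.+-identityˡ _)

nonNeg-multiple-cancel : ∀ {C D} N → ℚ.NonNegative N → C ≡ N ℚ.* D → C ℚ.+ D ≡ 0ℚ → D ≡ 0ℚ
nonNeg-multiple-cancel {C} {D} N N≥0 C≡N*D C+D≡0 = begin
  D                                ≡⟨ ℚₚ.*-identityˡ D ⟨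
  1ℚ ℚ.* D                         ≡⟨ cong (ℚ._* D) (ℚₚ.*-inverseˡ P {{P≢0}}) ⟨
  (ℚ.1/_ P {{P≢0}} ℚ.* P) ℚ.* D     ≡⟨ ℚₚ.*-assoc (ℚ.1/_ P {{P≢0}}) P D ⟩
  ℚ.1/_ P {{P≢0}} ℚ.* (P ℚ.* D)     ≡⟨ cong (ℚ.1/_ P {{P≢0}} ℚ.*_) P*D≡0 ⟩
  ℚ.1/_ P {{P≢0}} ℚ.* 0ℚ            ≡⟨ ℚₚ.*-zeroʳ (ℚ.1/_ P {{P≢0}}) ⟩
  0ℚ                               ∎
  where
  open ≡-Reasoning
  open +-*-Solver
  P = 1ℚ ℚ.+ N
  P≢0 : ℚ.NonZero P
  P≢0 = ℚₚ.pos⇒nonZero P {{ℚₚ.pos+nonNeg⇒pos 1ℚ N {{N≥0}}}}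
  P*D≡0 : P ℚ.* D ≡ 0ℚ
  P*D≡0 = trans (solve 2 (λ N D → (con 1ℚ :+ N) :* D := N :* D :+ D) refl N D)
                (trans (cong (ℚ._+ D) (sym C≡N*D)) C+D≡0)

module Coefficients
  (a b : ℕ) (a-prime : Prime a) (b-prime : Prime b) (a≢b : a ≢ b)
  (b⁻¹ a⁻¹ : ℤ) (bb⁻¹≡1 : + a ∣ₛ + b ℤ.* b⁻¹ ℤ.- + 1) (aa⁻¹≡1 : + b ∣ₛ + a ℤ.* a⁻¹ ℤ.- + 1)
  where

  m : ℕ
  m = a * b

  2≤a : 2 ≤ a
  2≤a = prime⇒2≤ a-prime

  2≤b : 2 ≤ b
  2≤b = prime⇒2≤ b-prime

  instance
    m≢0 : NonZero m
    m≢0 = ℕₚ.m*n≢0 a b {{prime⇒nonZero a-prime}} {{prime⇒nonZero b-prime}}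

  m∣⇒a∣ : ∀ {x} → + m ∣ₛ x → + a ∣ₛ x
  m∣⇒a∣ = Signed.∣-trans (∣ᵤ⇒∣ (ℕ.m∣m*n b))

  m∣⇒b∣ : ∀ {x} → + m ∣ₛ x → + b ∣ₛ x
  m∣⇒b∣ = Signed.∣-trans (∣ᵤ⇒∣ (ℕ.n∣m*n a))

  mod-m⇒mod-a : ∀ {x y} → x ≡± y mod m → x ≡± y mod a
  mod-m⇒mod-a = ≡±-∣ (ℕ.m∣m*n b)

  mod-m⇒mod-b : ∀ {x y} → x ≡± y mod m → x ≡± y mod b
  mod-m⇒mod-b = ≡±-∣ (ℕ.n∣m*n a)

  crt : ∀ x y → ∃ λ j → j < m × + a ∣ₛ + j ℤ.- x × + b ∣ₛ + j ℤ.- y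
  crt x y = j , ℤ.n%ℕd<d J m , ∣-shift J x (+ j) a∣J-x (m∣⇒a∣ m∣J-j)
                             , ∣-shift J y (+ j) b∣J-y (m∣⇒b∣ m∣J-j)
    where
    J = x ℤ.* (+ b ℤ.* b⁻¹) ℤ.+ y ℤ.* (+ a ℤ.* a⁻¹)
    j = J %ℕ m
    m∣J-j = n∣x-x%n J m
    a∣J-x : + a ∣ₛ J ℤ.- x
    a∣J-x = ∣-lincomb _ x (y ℤ.* a⁻¹) bb⁻¹≡1 (Signed.∣-refl) (eq x (+ b) b⁻¹ y (+ a) a⁻¹)
      where eq : ∀ x b b⁻¹ y a a⁻¹ → x ℤ.* (b ℤ.* b⁻¹) ℤ.+ y ℤ.* (a ℤ.* a⁻¹) ℤ.- x ≡
                   x ℤ.* (b ℤ.* b⁻¹ ℤ.- + 1) ℤ.+ y ℤ.* a⁻¹ ℤ.* a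
            eq = solve-∀
    b∣J-y : + b ∣ₛ J ℤ.- y
    b∣J-y = ∣-lincomb _ y (x ℤ.* b⁻¹) aa⁻¹≡1 (Signed.∣-refl) (eq x (+ b) b⁻¹ y (+ a) a⁻¹)
      where eq : ∀ x b b⁻¹ y a a⁻¹ → x ℤ.* (b ℤ.* b⁻¹) ℤ.+ y ℤ.* (a ℤ.* a⁻¹) ℤ.- y ≡
                   y ℤ.* (a ℤ.* a⁻¹ ℤ.- + 1) ℤ.+ x ℤ.* b⁻¹ ℤ.* b
            eq = solve-∀

  ∈Jset⁻ : ∀ {j} → j ∈ Jset a b → ∃ λ j′ → j ≡ suc j′ × a ℕ.∣ j′ × gcd (suc j′) b ≡ 1
  ∈Jset⁻ j∈ with ∈-filter⁻ (T? ∘ _) {xs = map suc (upTo m)} j∈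
  ... | j∈suc[upTo] , conditions with ∈-map⁻ suc j∈suc[upTo]
  ... | j′ , _ , refl with Equivalence.to (T-∧ {⌊ a ℕ.∣? j′ ⌋} {gcd (suc j′) b == 1}) conditions
  ... | a∣j′ , coprime = j′ , refl , toWitness a∣j′ , toWitness coprime

  ∈Jset⁺ : ∀ {j′} → j′ < m → a ℕ.∣ j′ → gcd (suc j′) b ≡ 1 → suc j′ ∈ Jset a b
  ∈Jset⁺ {j′} j′<m a∣j′ coprime = ∈-filter⁺ (T? ∘ _) (∈-map⁺ suc (∈-upTo⁺ j′<m))
    (Equivalence.from (T-∧ {⌊ a ℕ.∣? j′ ⌋} {gcd (suc j′) b == 1}) (fromWitness a∣j′ , fromWitness coprime))

  inC-sound : ∀ k i → gcd ∣ k ∣ b ≡ 1 → T (inC a b k i) → + i ≡± k mod a × ¬ + b ∣ₛ + i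
  inC-sound k i coprime-k inC-true with find (any⁻ _ (Jset a b) inC-true)
  ... | j , j∈ , red≡i with ∈Jset⁻ j∈
  ... | j′ , refl , a∣j′ , coprime-j = ≡±-trans (≡±-sym (mod-m⇒mod-a kj≡±i)) kj≡±k , b∤i
    where
    kj≡±i : k ℤ.* + suc j′ ≡± + i mod m
    kj≡±i = subst (λ r → k ℤ.* + suc j′ ≡± + r mod m) (toWitness red≡i) (red-≡± m (k ℤ.* + suc j′))
    kj≡±k : k ℤ.* + suc j′ ≡± k mod a
    kj≡±k = plus (∣-multiple _ k (∣ᵤ⇒∣ a∣j′) (eq k (+ j′)))
      where eq : ∀ k j′ → k ℤ.* (+ 1 ℤ.+ j′) ℤ.- k ≡ k ℤ.* j′
            eq = solve-∀
    b∤i : ¬ + b ∣ₛ + i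
    b∤i b∣i with prime-∣-* b-prime k (+ suc j′) (≡±-resp-∣ (≡±-sym (mod-m⇒mod-b kj≡±i)) b∣i)
    ... | inj₁ b∣k = gcd≡1⇒∤ k 2≤b coprime-k b∣k
    ... | inj₂ b∣j = gcd≡1⇒∤ (+ suc j′) 2≤b coprime-j b∣j

  solve-in-Jset : ∀ k t → gcd ∣ k ∣ b ≡ 1 → + a ∣ₛ t ℤ.- k → ¬ + b ∣ₛ t →
    ∃ λ j → j ∈ Jset a b × + m ∣ₛ k ℤ.* + j ℤ.- t
  solve-in-Jset k t coprime-k a∣t-k b∤t = from-crt (crt (+ 1) (k⁻¹ ℤ.* t))
    where
    -- Consumed by a helper rather than by `with`: with-abstracting over the crt term is
    -- prohibitively expensive to typecheck.
    k⁻¹ = proj₁ (∃-inverse-mod k coprime-k)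
    k⁻¹k≡1 = proj₂ (∃-inverse-mod k coprime-k)
    from-crt : (∃ λ j → j < m × + a ∣ₛ + j ℤ.- + 1 × + b ∣ₛ + j ℤ.- k⁻¹ ℤ.* t) →
      ∃ λ j → j ∈ Jset a b × + m ∣ₛ k ℤ.* + j ℤ.- t
    from-crt (zero , _ , a∣0-1 , _) = ⊥-elim (2≤⇒∤1 2≤a (∣-multiple _ (ℤ.- + 1) a∣0-1 refl))
    from-crt (suc j′ , j<m , a∣j-1 , b∣j-k⁻¹t) = suc j′ , j∈ , m∣kj-t
      where
      j = + suc j′
      a∣kj-t : + a ∣ₛ k ℤ.* j ℤ.- t
      a∣kj-t = ∣-lincomb _ k (ℤ.- + 1) a∣j-1 a∣t-k (eq k j t)
        where eq : ∀ k j t → k ℤ.* j ℤ.- t ≡ k ℤ.* (j ℤ.- + 1) ℤ.+ ℤ.- + 1 ℤ.* (t ℤ.- k)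
              eq = solve-∀
      b∣kj-t : + b ∣ₛ k ℤ.* j ℤ.- t
      b∣kj-t = ∣-lincomb _ k t b∣j-k⁻¹t k⁻¹k≡1 (eq k j t k⁻¹)
        where eq : ∀ k j t u → k ℤ.* j ℤ.- t ≡ k ℤ.* (j ℤ.- u ℤ.* t) ℤ.+ t ℤ.* (u ℤ.* k ℤ.- + 1)
              eq = solve-∀
      m∣kj-t : + m ∣ₛ k ℤ.* j ℤ.- t
      m∣kj-t = coprime-∣-∧-∣⇒*-∣ (distinct-primes-coprime a-prime b-prime a≢b) a∣kj-t b∣kj-t
      b∤j : ¬ b ℕ.∣ suc j′
      b∤j b∣j = b∤t (∣-lincomb _ k (ℤ.- + 1) (∣ᵤ⇒∣ b∣j) b∣kj-t (eq k j t))
        where eq : ∀ k j t → t ≡ k ℤ.* j ℤ.+ ℤ.- + 1 ℤ.* (k ℤ.* j ℤ.- t)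
              eq = solve-∀
      j∈ : suc j′ ∈ Jset a b
      j∈ = ∈Jset⁺ (ℕₚ.<-trans (ℕₚ.n<1+n j′) j<m) (∣⇒∣ᵤ a∣j-1) (prime∤⇒gcd≡1 b-prime b∤j)

  Jset-solution : ∀ k i → gcd ∣ k ∣ b ≡ 1 → + i ≡± k mod a → ¬ + b ∣ₛ + i →
    ∃ λ j → j ∈ Jset a b × k ℤ.* + j ≡± + i mod m
  Jset-solution k i coprime-k (plus a∣i-k) b∤i =
    let j , j∈ , m∣kj-i = solve-in-Jset k (+ i) coprime-k a∣i-k b∤i in j , j∈ , plus m∣kj-i
  Jset-solution k i coprime-k (minus a∣i+k) b∤i =
    let j , j∈ , m∣kj+i = solve-in-Jset k (ℤ.- + i) coprime-k (∣-multiple _ (ℤ.- + 1) a∣i+k (eq₁ (+ i) k))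
                                         (λ b∣-i → b∤i (∣-multiple _ (ℤ.- + 1) b∣-i (eq₂ (+ i))))
    in j , j∈ , minus (subst (_ ∣ₛ_) (eq₃ (k ℤ.* + j) (+ i)) m∣kj+i)
    where
    eq₁ : ∀ i k → ℤ.- i ℤ.- k ≡ ℤ.- + 1 ℤ.* (i ℤ.+ k)
    eq₁ = solve-∀
    eq₂ : ∀ i → i ≡ ℤ.- + 1 ℤ.* ℤ.- i
    eq₂ = solve-∀
    eq₃ : ∀ x i → x ℤ.- ℤ.- i ≡ x ℤ.+ i
    eq₃ = solve-∀

  inC-complete : ∀ k i → gcd ∣ k ∣ b ≡ 1 → i ≤ ⌊ m /2⌋ → + i ≡± k mod a → ¬ + b ∣ₛ + i →
    T (inC a b k i)
  inC-complete k i coprime-k i≤m′ i≡±k b∤i =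
    let j , j∈ , kj≡±i = Jset-solution k i coprime-k i≡±k b∤i
    in any⁺ _ (lose j∈ (fromWitness (red-unique m (k ℤ.* + j) i≤m′ kj≡±i)))

  inC≡⌊≡±?⌋ : ∀ k i → gcd ∣ k ∣ b ≡ 1 → i ≤ ⌊ m /2⌋ → ¬ + b ∣ₛ + i →
    inC a b k i ≡ ⌊ + i ≡±? k mod a ⌋
  inC≡⌊≡±?⌋ k i coprime-k i≤m′ b∤i = T⇔⇒≡⌊⌋ (+ i ≡±? k mod a) (proj₁ ∘ inC-sound k i coprime-k)
    (λ i≡±k → inC-complete k i coprime-k i≤m′ i≡±k b∤i)

  b∣i⇒inC≡false : ∀ k i → gcd ∣ k ∣ b ≡ 1 → + b ∣ₛ + i → inC a b k i ≡ false
  b∣i⇒inC≡false k i coprime-k b∣i =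
    T⇔⇒≡⌊⌋ (no (λ b∤i → b∤i b∣i)) (proj₂ ∘ inC-sound k i coprime-k) (λ b∤i → ⊥-elim (b∤i b∣i))

  δ-≢ : ∀ {x i} → x ≢ i → δ x i ≡ 0ℚ
  δ-≢ {x} {i} = 𝟙-no (x ℕₚ.≟ i)

  b∣X⇒δ-red≡0 : ∀ X i → + b ∣ₛ X → ¬ + b ∣ₛ + i → δ (red m X) i ≡ 0ℚ
  b∣X⇒δ-red≡0 X i b∣X b∤i = δ-≢ λ red≡i →
    b∤i (≡±-resp-∣ (subst (λ r → X ≡± + r mod b) red≡i (mod-m⇒mod-b (red-≡± m X))) b∣X)

  Rform-b∤i : ∀ k i → gcd ∣ k ∣ b ≡ 1 → i ≤ ⌊ m /2⌋ → ¬ + b ∣ₛ + i →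
    Rform a b b⁻¹ k i ≡ 𝟙 ⌊ + i ≡±? k mod a ⌋ ℚ.- 𝟙 ⌊ + i ≡±? + 1 mod a ⌋
  Rform-b∤i k i coprime-k i≤m′ b∤i =
    trans (drop-zeros (𝟙 (inC a b k i)) (𝟙 (inC a b (+ 1) i))
                      (b∣X⇒δ-red≡0 _ i (b∣b* k) b∤i)
                      (b∣X⇒δ-red≡0 _ i (Signed.∣m⇒∣m*n k (b∣b* b⁻¹)) b∤i)
                      (b∣X⇒δ-red≡0 _ i (b∣b* b⁻¹) b∤i)
                      (δ-≢ λ b≡i → b∤i (subst (λ n → + b ∣ₛ + n) b≡i Signed.∣-refl)))
          (cong₂ (λ x y → 𝟙 x ℚ.- 𝟙 y) (inC≡⌊≡±?⌋ k i coprime-k i≤m′ b∤i)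
                                       (inC≡⌊≡±?⌋ (+ 1) i (gcd-zeroˡ b) i≤m′ b∤i))
    where
    b∣b* : ∀ x → + b ∣ₛ + b ℤ.* x
    b∣b* x = Signed.∣m⇒∣m*n x Signed.∣-refl
    drop-zeros : ∀ x y {z₁ z₂ z₃ z₄} → z₁ ≡ 0ℚ → z₂ ≡ 0ℚ → z₃ ≡ 0ℚ → z₄ ≡ 0ℚ →
      x ℚ.- y ℚ.- z₁ ℚ.+ z₂ ℚ.- z₃ ℚ.+ z₄ ≡ x ℚ.- y
    drop-zeros x y refl refl refl refl =
      solve 2 (λ x y → x :- y :- con 0ℚ :+ con 0ℚ :- con 0ℚ :+ con 0ℚ := x :- y) refl x y
      where open +-*-Solver

  b≤m′ : b ≤ ⌊ m /2⌋
  b≤m′ = begin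
    b                ≡⟨ ℕₚ.n≡⌊n+n/2⌋ b ⟩
    ⌊ b + b /2⌋       ≡⟨ cong (λ n → ⌊ b + n /2⌋) (ℕₚ.+-identityʳ b) ⟨
    ⌊ 2 * b /2⌋       ≤⟨ ℕₚ.⌊n/2⌋-mono (ℕₚ.*-monoˡ-≤ b 2≤a) ⟩
    ⌊ m /2⌋           ∎
    where open ℕₚ.≤-Reasoning

  δ-red-b* : ∀ y → δ (red m (+ b ℤ.* y)) b ≡ 𝟙 ⌊ y ≡±? + 1 mod a ⌋
  δ-red-b* y = cong 𝟙 (⌊⌋-⇔ (red m (+ b ℤ.* y) ℕₚ.≟ b) (y ≡±? + 1 mod a) red≡b⇒ ⇒red≡b)
    where
    b≡b*1 : + b ≡ + b ℤ.* + 1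
    b≡b*1 = sym (ℤₚ.*-identityʳ (+ b))
    red≡b⇒ : red m (+ b ℤ.* y) ≡ b → y ≡± + 1 mod a
    red≡b⇒ red≡b = ≡±-*-cancel a b {{prime⇒nonZero b-prime}}
      (subst (λ r → + b ℤ.* y ≡± r mod m) b≡b*1
        (subst (λ r → + b ℤ.* y ≡± + r mod m) red≡b (red-≡± m (+ b ℤ.* y))))
    ⇒red≡b : y ≡± + 1 mod a → red m (+ b ℤ.* y) ≡ b
    ⇒red≡b y≡±1 = red-unique m (+ b ℤ.* y) b≤m′
      (subst (λ r → + b ℤ.* y ≡± r mod m) (sym b≡b*1) (≡±-*-mono a b y≡±1))

  b⁻¹x≡±1⇒x≡±b : ∀ {x} → b⁻¹ ℤ.* x ≡± + 1 mod a → x ≡± + b mod a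
  b⁻¹x≡±1⇒x≡±b {x} b⁻¹x≡±1 =
    ≡±-trans x≡±bb⁻¹x
      (subst (λ r → + b ℤ.* (b⁻¹ ℤ.* x) ≡± r mod a) (ℤₚ.*-identityʳ (+ b)) (≡±-*ˡ (+ b) b⁻¹x≡±1))
    where
    x≡±bb⁻¹x : x ≡± + b ℤ.* (b⁻¹ ℤ.* x) mod a
    x≡±bb⁻¹x = plus (∣-multiple _ (ℤ.- x) bb⁻¹≡1 (eq x (+ b) b⁻¹))
      where eq : ∀ x b b⁻¹ → x ℤ.- b ℤ.* (b⁻¹ ℤ.* x) ≡ ℤ.- x ℤ.* (b ℤ.* b⁻¹ ℤ.- + 1)
            eq = solve-∀

  x≡±b⇒b⁻¹x≡±1 : ∀ {x} → x ≡± + b mod a → b⁻¹ ℤ.* x ≡± + 1 mod a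
  x≡±b⇒b⁻¹x≡±1 x≡±b =
    ≡±-trans (≡±-*ˡ b⁻¹ x≡±b) (plus (subst (λ t → + a ∣ₛ t ℤ.- + 1) (ℤₚ.*-comm (+ b) b⁻¹) bb⁻¹≡1))

  Rform-i≡b : ∀ k → gcd ∣ k ∣ b ≡ 1 → ¬ k ≡± + 1 mod a →
    Rform a b b⁻¹ k b ≡ 𝟙 ⌊ k ≡±? + b mod a ⌋ ℚ.- 𝟙 ⌊ + b ≡±? + 1 mod a ⌋ ℚ.+ 1ℚ
  Rform-i≡b k coprime-k k≢±1 = collapse
    (cong 𝟙 (b∣i⇒inC≡false k b coprime-k Signed.∣-refl))
    (cong 𝟙 (b∣i⇒inC≡false (+ 1) b (gcd-zeroˡ b) Signed.∣-refl))
    (trans (δ-red-b* k) (𝟙-no (k ≡±? + 1 mod a) k≢±1))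
    (trans (cong (λ t → δ (red m t) b) (ℤₚ.*-assoc (+ b) b⁻¹ k))
           (trans (δ-red-b* (b⁻¹ ℤ.* k)) (cong 𝟙 ⌊b⁻¹k≡±1⌋≡⌊k≡±b⌋)))
    (trans (δ-red-b* b⁻¹) (cong 𝟙 ⌊b⁻¹≡±1⌋≡⌊b≡±1⌋))
    (𝟙-yes (b ℕₚ.≟ b) refl)
    where
    ⌊b⁻¹k≡±1⌋≡⌊k≡±b⌋ : ⌊ b⁻¹ ℤ.* k ≡±? + 1 mod a ⌋ ≡ ⌊ k ≡±? + b mod a ⌋
    ⌊b⁻¹k≡±1⌋≡⌊k≡±b⌋ = ⌊⌋-⇔ (b⁻¹ ℤ.* k ≡±? + 1 mod a) (k ≡±? + b mod a) b⁻¹x≡±1⇒x≡±b x≡±b⇒b⁻¹x≡±1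
    b⁻¹≡b⁻¹*1 : b⁻¹ ≡ b⁻¹ ℤ.* + 1
    b⁻¹≡b⁻¹*1 = sym (ℤₚ.*-identityʳ b⁻¹)
    ⌊b⁻¹≡±1⌋≡⌊b≡±1⌋ : ⌊ b⁻¹ ≡±? + 1 mod a ⌋ ≡ ⌊ + b ≡±? + 1 mod a ⌋
    ⌊b⁻¹≡±1⌋≡⌊b≡±1⌋ = ⌊⌋-⇔ (b⁻¹ ≡±? + 1 mod a) (+ b ≡±? + 1 mod a)
      (λ b⁻¹≡±1 → ≡±-sym (b⁻¹x≡±1⇒x≡±b (subst (λ t → t ≡± + 1 mod a) b⁻¹≡b⁻¹*1 b⁻¹≡±1)))
      (λ b≡±1 → subst (λ t → t ≡± + 1 mod a) (sym b⁻¹≡b⁻¹*1) (x≡±b⇒b⁻¹x≡±1 (≡±-sym b≡±1)))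
    collapse : ∀ {x₁ x₂ x₃ x₄ x₅ x₆ A B} → x₁ ≡ 0ℚ → x₂ ≡ 0ℚ → x₃ ≡ 0ℚ → x₄ ≡ A → x₅ ≡ B → x₆ ≡ 1ℚ →
      x₁ ℚ.- x₂ ℚ.- x₃ ℚ.+ x₄ ℚ.- x₅ ℚ.+ x₆ ≡ A ℚ.- B ℚ.+ 1ℚ
    collapse {A = A} {B} refl refl refl refl refl refl =
      solve 2 (λ A B → con 0ℚ :- con 0ℚ :- con 0ℚ :+ A :- B :+ con 1ℚ := A :- B :+ con 1ℚ) refl A B
      where open +-*-Solver

  Rform-i≡±1 : ∀ k i → gcd ∣ k ∣ b ≡ 1 → ¬ k ≡± + 1 mod a → i ≤ ⌊ m /2⌋ → ¬ + b ∣ₛ + i →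
    + i ≡± + 1 mod a → Rform a b b⁻¹ k i ≡ ℚ.- 1ℚ
  Rform-i≡±1 k i coprime-k k≢±1 i≤m′ b∤i i≡±1 = trans (Rform-b∤i k i coprime-k i≤m′ b∤i)
    (cong₂ ℚ._-_ (𝟙-no (+ i ≡±? k mod a) (λ i≡±k → k≢±1 (≡±-trans (≡±-sym i≡±k) i≡±1)))
                 (𝟙-yes (+ i ≡±? + 1 mod a) i≡±1))

  Rform-i≢±1 : ∀ k i → gcd ∣ k ∣ b ≡ 1 → i ≤ ⌊ m /2⌋ → ¬ + b ∣ₛ + i →
    ¬ + i ≡± + 1 mod a → Rform a b b⁻¹ k i ≡ 0ℚ ℚ.+ 𝟙 ⌊ + i ≡±? k mod a ⌋
  Rform-i≢±1 k i coprime-k i≤m′ b∤i i≢±1 = trans (Rform-b∤i k i coprime-k i≤m′ b∤i)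
    (trans (cong (λ t → 𝟙 ⌊ + i ≡±? k mod a ⌋ ℚ.- t) (𝟙-no (+ i ≡±? + 1 mod a) i≢±1))
           (trans (ℚₚ.+-identityʳ x) (sym (ℚₚ.+-identityˡ x))))
    where x = 𝟙 ⌊ + i ≡±? k mod a ⌋

  red-≡±-mod-a : ∀ X {u} → + a ∣ₛ X ℤ.- u → + red m X ≡± u mod a
  red-≡±-mod-a X a∣X-u = ≡±-trans (≡±-sym (mod-m⇒mod-a (red-≡± m X))) (plus a∣X-u)

  red-≡±-mod-b : ∀ X {v} → + b ∣ₛ X ℤ.- v → + red m X ≡± v mod b
  red-≡±-mod-b X b∣X-v = ≡±-trans (≡±-sym (mod-m⇒mod-b (red-≡± m X))) (plus b∣X-v)

module Admissible {x y : ℕ} {H : List ℤ} (H-admissible : IsH x y H) (1∈H : + 1 ∈ H) where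

  coprime : ∀ {k} → k ∈ remove1 H → gcd ∣ k ∣ y ≡ 1
  coprime k∈ = All.lookup (proj₁ H-admissible) (proj₁ (∈-remove1⁻ {H} k∈))

  distinct : AllPairs (λ k k′ → ¬ k ≡± k′ mod x) H
  distinct = AllPairs.map ¬∣∧¬∣⇒≢± (proj₂ (proj₂ H-admissible))
    where
    ¬∣∧¬∣⇒≢± : ∀ {k k′} → ¬ (+ x ∣ (k ℤ.- k′)) × ¬ (+ x ∣ (k ℤ.+ k′)) → ¬ k ≡± k′ mod x
    ¬∣∧¬∣⇒≢± (x∤k-k′ , _) (plus x∣k-k′)  = x∤k-k′ (∣⇒∣ᵤ x∣k-k′)
    ¬∣∧¬∣⇒≢± (_ , x∤k+k′) (minus x∣k+k′) = x∤k+k′ (∣⇒∣ᵤ x∣k+k′)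

  ≢±1 : ∀ {k} → k ∈ remove1 H → ¬ k ≡± + 1 mod x
  ≢±1 k∈ = allPairs-lookup (λ ≢± → ≢± ∘ ≡±-sym) distinct (proj₁ k∈H×k≢1) 1∈H (proj₂ k∈H×k≢1)
    where k∈H×k≢1 = ∈-remove1⁻ {H} k∈

  at-most-one : ∀ {P : ℤ → Set} → (∀ {k k′} → P k → P k′ → k ≡± k′ mod x) →
    AllPairs (λ k k′ → ¬ (P k × P k′)) (remove1 H)
  at-most-one P⇒≡± = AllPairs.map (λ k≢±k′ (Pk , Pk′) → k≢±k′ (P⇒≡± Pk Pk′)) (filter⁺ _ distinct)

  covers : .{{_ : NonZero x}} → ¬ 2 ℕ.∣ x → ∀ t → ¬ + x ∣ₛ t → ∃ λ l → l ∈ H × l ≡± t mod x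
  covers 2∤x t x∤t = l , l∈ , ≡±-trans (plus (∣ᵤ⇒∣ x∣l-j)) (≡±-sym (red-≡± x t))
    where
    j = red x t
    j≢0 : j ≢ 0
    j≢0 j≡0 = x∤t (≡±0⇒∣ (subst (λ r → t ≡± + r mod x) j≡0 (red-≡± x t)))
    cover = proj₁ (proj₂ H-admissible) j (ℕₚ.n≢0⇒n>0 j≢0)
                  (ℕₚ.≤-trans (red≤⌊/2⌋ x t) (odd⇒⌊n/2⌋≤⌊n∸1/2⌋ x 2∤x))
    l = proj₁ cover
    l∈ = proj₁ (proj₂ cover)
    x∣l-j = proj₂ (proj₂ cover)

module VanishingCombination
  (a b : ℕ) (a-prime : Prime a) (b-prime : Prime b) (a≢b : a ≢ b) (3≤a : 3 ≤ a) (3≤b : 3 ≤ b)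
  (b⁻¹ a⁻¹ : ℤ) (bb⁻¹≡1 : + a ∣ₛ + b ℤ.* b⁻¹ ℤ.- + 1) (aa⁻¹≡1 : + b ∣ₛ + a ℤ.* a⁻¹ ℤ.- + 1)
  {Ha Hb : List ℤ} (Ha-admissible : IsH a b Ha) (Hb-admissible : IsH b a Hb)
  (1∈Ha : + 1 ∈ Ha) (1∈Hb : + 1 ∈ Hb)
  (c d : ℤ → ℚ)
  (vanishes : (i : ℕ) → 2 ≤ i → i ≤ ⌊ a * b /2⌋ →
    Σℚ (map (λ k → c k ℚ.* Rform a b b⁻¹ k i) (remove1 Ha))
      ℚ.+ Σℚ (map (λ l → d l ℚ.* Rform b a a⁻¹ l i) (remove1 Hb)) ≡ 0ℚ)
  where

  module A = Coefficients a b a-prime b-prime a≢b b⁻¹ a⁻¹ bb⁻¹≡1 aa⁻¹≡1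
  module B = Coefficients b a b-prime a-prime (a≢b ∘ sym) a⁻¹ b⁻¹ aa⁻¹≡1 bb⁻¹≡1
  module HA = Admissible Ha-admissible 1∈Ha
  module HB = Admissible Hb-admissible 1∈Hb
  open +-*-Solver

  m : ℕ
  m = a * b

  C D : ℚ
  C = Σℚ (map c (remove1 Ha))
  D = Σℚ (map d (remove1 Hb))

  ΣA ΣB : ℕ → ℚ
  ΣA i = Σℚ (map (λ k → c k ℚ.* Rform a b b⁻¹ k i) (remove1 Ha))
  ΣB i = Σℚ (map (λ l → d l ℚ.* Rform b a a⁻¹ l i) (remove1 Hb))

  vanishes-at : ∀ {i X Y} → 2 ≤ i → i ≤ ⌊ m /2⌋ → ΣA i ≡ X → ΣB i ≡ Y → X ℚ.+ Y ≡ 0ℚ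
  vanishes-at {i} 2≤i i≤m′ ΣA≡X ΣB≡Y = trans (cong₂ ℚ._+_ (sym ΣA≡X) (sym ΣB≡Y)) (vanishes i 2≤i i≤m′)

  ≤⌊m/2⌋⇒≤⌊ba/2⌋ : ∀ {i} → i ≤ ⌊ m /2⌋ → i ≤ ⌊ b * a /2⌋
  ≤⌊m/2⌋⇒≤⌊ba/2⌋ {i} = subst (λ n → i ≤ ⌊ n /2⌋) (ℕₚ.*-comm a b)

  a∤k⇒c≡D : ∀ {k} → k ∈ remove1 Ha → ¬ + a ∣ₛ k → c k ≡ D
  a∤k⇒c≡D {k} k∈ a∤k = begin
    c k
      ≡⟨ solve 3 (λ C ck D → ck := (C :* con 0ℚ :+ ck) :+ D :* (:- con 1ℚ) :+ D) refl C (c k) D ⟩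
    (C ℚ.* 0ℚ ℚ.+ c k) ℚ.+ D ℚ.* (ℚ.- 1ℚ) ℚ.+ D
      ≡⟨ cong (ℚ._+ D) (vanishes-at 2≤i i≤m′ ΣA≡ ΣB≡) ⟩
    0ℚ ℚ.+ D
      ≡⟨ ℚₚ.+-identityˡ D ⟩
    D ∎
    where
    open ≡-Reasoning
    crt = A.crt k (+ 1)
    j = proj₁ crt
    i = red m (+ j)
    i≡±k : + i ≡± k mod a
    i≡±k = A.red-≡±-mod-a (+ j) (proj₁ (proj₂ (proj₂ crt)))
    i≡±1[b] : + i ≡± + 1 mod b
    i≡±1[b] = A.red-≡±-mod-b (+ j) (proj₂ (proj₂ (proj₂ crt)))
    a∤i : ¬ + a ∣ₛ + i
    a∤i = a∤k ∘ ≡±-resp-∣ i≡±k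
    b∤i : ¬ + b ∣ₛ + i
    b∤i = 2≤⇒∤1 A.2≤b ∘ ≡±-resp-∣ i≡±1[b]
    i≢±1 : ¬ + i ≡± + 1 mod a
    i≢±1 i≡±1 = HA.≢±1 k∈ (≡±-trans (≡±-sym i≡±k) i≡±1)
    2≤i : 2 ≤ i
    2≤i = ≢0∧≢1⇒2≤ (λ i≡0 → a∤i (subst (λ n → + a ∣ₛ + n) (sym i≡0) (Signed.divides (+ 0) refl)))
                   (λ i≡1 → i≢±1 (subst (λ n → + n ≡± + 1 mod a) (sym i≡1) (≡±-refl (+ 1))))
    i≤m′ : i ≤ ⌊ m /2⌋
    i≤m′ = red≤⌊/2⌋ m (+ j)
    ΣA≡ : ΣA i ≡ C ℚ.* 0ℚ ℚ.+ c k
    ΣA≡ = Σℚ-*-indicator (λ x → + i ≡±? x mod a) c _ 0ℚ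
            (HA.at-most-one (λ i≡±x i≡±y → ≡±-trans (≡±-sym i≡±x) i≡±y))
            (λ x x∈ → A.Rform-i≢±1 x i (HA.coprime x∈) i≤m′ b∤i i≢±1) k∈ i≡±k
    ΣB≡ : ΣB i ≡ D ℚ.* (ℚ.- 1ℚ)
    ΣB≡ = Σℚ-*-const d _ _ (remove1 Hb)
            (λ l l∈ → B.Rform-i≡±1 l i (HB.coprime l∈) (HB.≢±1 l∈) (≤⌊m/2⌋⇒≤⌊ba/2⌋ i≤m′) a∤i i≡±1[b])

  C+D≡0 : C ℚ.+ D ≡ 0ℚ
  C+D≡0 = begin
    C ℚ.+ D
      ≡⟨ solve 2 (λ C D → C :+ D := :- (C :* (:- con 1ℚ) :+ D :* (:- con 1ℚ))) refl C D ⟩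
    ℚ.- (C ℚ.* (ℚ.- 1ℚ) ℚ.+ D ℚ.* (ℚ.- 1ℚ))
      ≡⟨ cong ℚ.-_ (vanishes-at 2≤i i≤m′ ΣA≡ ΣB≡) ⟩
    0ℚ ∎
    where
    open ≡-Reasoning
    crt = A.crt (+ 1) (ℤ.- + 1)
    j = proj₁ crt
    a∣j-1 = proj₁ (proj₂ (proj₂ crt))
    b∣j+1 = proj₂ (proj₂ (proj₂ crt))
    i = red m (+ j)
    i≡±1[a] : + i ≡± + 1 mod a
    i≡±1[a] = A.red-≡±-mod-a (+ j) a∣j-1
    i≡±1[b] : + i ≡± + 1 mod b
    i≡±1[b] = ≡±-trans (A.red-≡±-mod-b (+ j) b∣j+1) (≡±-neg (+ 1))
    a∤i : ¬ + a ∣ₛ + i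
    a∤i = 2≤⇒∤1 A.2≤a ∘ ≡±-resp-∣ i≡±1[a]
    b∤i : ¬ + b ∣ₛ + i
    b∤i = 2≤⇒∤1 A.2≤b ∘ ≡±-resp-∣ i≡±1[b]
    i≢1 : i ≢ 1
    i≢1 i≡1 with subst (λ n → + j ≡± + n mod m) i≡1 (red-≡± m (+ j))
    ... | plus m∣j-1  = 3≤⇒∤2 3≤b (∣-lincomb _ (+ 1) (ℤ.- + 1) b∣j+1 (A.m∣⇒b∣ m∣j-1) (eq₁ (+ j)))
      where eq₁ : ∀ j → + 2 ≡ + 1 ℤ.* (j ℤ.- ℤ.- + 1) ℤ.+ ℤ.- + 1 ℤ.* (j ℤ.- + 1)
            eq₁ = solve-∀
    ... | minus m∣j+1 = 3≤⇒∤2 3≤a (∣-lincomb _ (+ 1) (ℤ.- + 1) (A.m∣⇒a∣ m∣j+1) a∣j-1 (eq₂ (+ j)))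
      where eq₂ : ∀ j → + 2 ≡ + 1 ℤ.* (j ℤ.+ + 1) ℤ.+ ℤ.- + 1 ℤ.* (j ℤ.- + 1)
            eq₂ = solve-∀
    2≤i : 2 ≤ i
    2≤i = ≢0∧≢1⇒2≤ (λ i≡0 → a∤i (subst (λ n → + a ∣ₛ + n) (sym i≡0) (Signed.divides (+ 0) refl))) i≢1
    i≤m′ : i ≤ ⌊ m /2⌋
    i≤m′ = red≤⌊/2⌋ m (+ j)
    ΣA≡ : ΣA i ≡ C ℚ.* (ℚ.- 1ℚ)
    ΣA≡ = Σℚ-*-const c _ _ (remove1 Ha)
            (λ k k∈ → A.Rform-i≡±1 k i (HA.coprime k∈) (HA.≢±1 k∈) i≤m′ b∤i i≡±1[a])
    ΣB≡ : ΣB i ≡ D ℚ.* (ℚ.- 1ℚ)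
    ΣB≡ = Σℚ-*-const d _ _ (remove1 Hb)
            (λ l l∈ → B.Rform-i≡±1 l i (HB.coprime l∈) (HB.≢±1 l∈) (≤⌊m/2⌋⇒≤⌊ba/2⌋ i≤m′) a∤i i≡±1[b])

  d-constant-off-b : Set
  d-constant-off-b = ∀ {l} → l ∈ remove1 Hb → ¬ + b ∣ₛ l → d l ≡ C

  a≤m′ : a ≤ ⌊ m /2⌋
  a≤m′ = subst (λ n → a ≤ ⌊ n /2⌋) (ℕₚ.*-comm b a) B.b≤m′

  b∤a : ¬ + b ∣ₛ + a
  b∤a = prime∤prime a-prime b-prime a≢b

  ΣA-at-a : ∀ {k} → k ∈ remove1 Ha → + a ∣ₛ k → ΣA a ≡ C ℚ.* 0ℚ ℚ.+ c k
  ΣA-at-a k∈ a∣k = Σℚ-*-indicator (λ x → + a ≡±? x mod a) c _ 0ℚ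
    (HA.at-most-one (λ a≡±x a≡±y → ≡±-trans (≡±-sym a≡±x) a≡±y))
    (λ x x∈ → A.Rform-i≢±1 x a (HA.coprime x∈) a≤m′ b∤a a≢±1)
    k∈ (plus (∣-lincomb _ (+ 1) (ℤ.- + 1) Signed.∣-refl a∣k (eq (+ a) _)))
    where
    a≢±1 : ¬ + a ≡± + 1 mod a
    a≢±1 a≡±1 = 2≤⇒∤1 A.2≤a (≡±-resp-∣ a≡±1 Signed.∣-refl)
    eq : ∀ a k → a ℤ.- k ≡ + 1 ℤ.* a ℤ.+ ℤ.- + 1 ℤ.* k
    eq = solve-∀

  a≡±1⇒ΣB-at-a : + a ≡± + 1 mod b → ΣB a ≡ D ℚ.* 0ℚ
  a≡±1⇒ΣB-at-a a≡±1 = Σℚ-*-const d _ _ (remove1 Hb) λ l l∈ →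
    trans (B.Rform-i≡b l (HB.coprime l∈) (HB.≢±1 l∈))
      (cong₂ (λ x y → x ℚ.- y ℚ.+ 1ℚ) (𝟙-no (l ≡±? + a mod b) (HB.≢±1 l∈ ∘ λ l≡±a → ≡±-trans l≡±a a≡±1))
                                     (𝟙-yes (+ a ≡±? + 1 mod b) a≡±1))

  a≢±1⇒ΣB-at-a : ¬ + a ≡± + 1 mod b →
    ∃ λ l → l ∈ remove1 Hb × ¬ + b ∣ₛ l × ΣB a ≡ D ℚ.* 1ℚ ℚ.+ d l
  a≢±1⇒ΣB-at-a a≢±1 = l , l∈ , b∤a ∘ ≡±-resp-∣ l≡±a ,
    Σℚ-*-indicator (λ x → x ≡±? + a mod b) d _ 1ℚ
      (HB.at-most-one (λ x≡±a y≡±a → ≡±-trans x≡±a (≡±-sym y≡±a)))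
      (λ x x∈ → let t = 𝟙 ⌊ x ≡±? + a mod b ⌋ in
        trans (B.Rform-i≡b x (HB.coprime x∈) (HB.≢±1 x∈))
          (trans (cong (λ y → t ℚ.- y ℚ.+ 1ℚ) (𝟙-no (+ a ≡±? + 1 mod b) a≢±1))
                 (solve 1 (λ t → t :- con 0ℚ :+ con 1ℚ := con 1ℚ :+ t) refl t)))
      l∈ l≡±a
    where
    cover = HB.covers {{prime⇒nonZero b-prime}} (odd-prime b-prime 3≤b) (+ a) b∤a
    l≡±a = proj₂ (proj₂ cover)
    l = proj₁ cover
    l∈ : l ∈ remove1 Hb
    l∈ = ∈-remove1⁺ (proj₁ (proj₂ cover))
           λ l≡1 → a≢±1 (≡±-sym (subst (λ t → t ≡± + a mod b) l≡1 l≡±a))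

  a∣k⇒c≡0 : d-constant-off-b → ∀ {k} → k ∈ remove1 Ha → + a ∣ₛ k → c k ≡ 0ℚ
  a∣k⇒c≡0 d≡C {k} k∈ a∣k = by-cases (+ a ≡±? + 1 mod b)
    where
    open ≡-Reasoning
    by-cases : Dec (+ a ≡± + 1 mod b) → c k ≡ 0ℚ
    by-cases (yes a≡±1) = begin
      c k
        ≡⟨ solve 3 (λ C ck D → ck := (C :* con 0ℚ :+ ck) :+ D :* con 0ℚ) refl C (c k) D ⟩
      (C ℚ.* 0ℚ ℚ.+ c k) ℚ.+ D ℚ.* 0ℚ
        ≡⟨ vanishes-at A.2≤a a≤m′ (ΣA-at-a k∈ a∣k) (a≡±1⇒ΣB-at-a a≡±1) ⟩
      0ℚ ∎
    by-cases (no a≢±1) = let l , l∈ , b∤l , ΣB≡ = a≢±1⇒ΣB-at-a a≢±1 in begin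
      c k
        ≡⟨ solve 3 (λ C ck D → ck := ((C :* con 0ℚ :+ ck) :+ (D :* con 1ℚ :+ C)) :- (C :+ D)) refl C (c k) D ⟩
      (C ℚ.* 0ℚ ℚ.+ c k) ℚ.+ (D ℚ.* 1ℚ ℚ.+ C) ℚ.- (C ℚ.+ D)
        ≡⟨ cong₂ ℚ._-_ (vanishes-at A.2≤a a≤m′ (ΣA-at-a k∈ a∣k) (trans ΣB≡ (cong (D ℚ.* 1ℚ ℚ.+_) (d≡C l∈ b∤l))))
                       C+D≡0 ⟩
      0ℚ ∎

  c≡D⊎c≡0 : d-constant-off-b → ∀ k → k ∈ remove1 Ha → c k ≡ D ⊎ c k ≡ 0ℚ
  c≡D⊎c≡0 d≡C k k∈ = by-cases (+ a Signed.∣? k)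
    where
    by-cases : Dec (+ a ∣ₛ k) → c k ≡ D ⊎ c k ≡ 0ℚ
    by-cases (yes a∣k) = inj₂ (a∣k⇒c≡0 d≡C k∈ a∣k)
    by-cases (no a∤k)  = inj₁ (a∤k⇒c≡D k∈ a∤k)

  c≡0 : d-constant-off-b → ∀ k → k ∈ remove1 Ha → c k ≡ 0ℚ
  c≡0 d≡C k k∈ = [ (λ ck≡D → trans ck≡D D≡0) , (λ ck≡0 → ck≡0) ]′ (c≡D⊎c≡0 d≡C k k∈)
    where
    D≡0 : D ≡ 0ℚ
    D≡0 = let N , N≥0 , C≡N*D = Σℚ-two-valued c D (remove1 Ha) (c≡D⊎c≡0 d≡C)
          in nonNeg-multiple-cancel {C} {D} N N≥0 C≡N*D C+D≡0

theorem3 : (p q : ℕ) → Prime p → Prime q → p ≢ q → 3 ≤ p → 3 ≤ q →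
    (Hp Hq : List ℤ) → IsH p q Hp → IsH q p Hq → + 1 ∈ Hp → + 1 ∈ Hq →
    (qs ps : ℤ) → + p ∣ (+ q ℤ.* qs ℤ.- + 1) → + q ∣ (+ p ℤ.* ps ℤ.- + 1) →
    (c d : ℤ → ℚ) →
    ((i : ℕ) → 2 ≤ i → i ≤ ⌊ p * q /2⌋ →
      Σℚ (map (λ k → c k ℚ.* Rform p q qs k i) (remove1 Hp))
        ℚ.+ Σℚ (map (λ l → d l ℚ.* Rform q p ps l i) (remove1 Hq)) ≡ 0ℚ) →
    ((k : ℤ) → k ∈ remove1 Hp → c k ≡ 0ℚ) × ((l : ℤ) → l ∈ remove1 Hq → d l ≡ 0ℚ)
theorem3 p q p-prime q-prime p≢q 3≤p 3≤q Hp Hq Hp-admissible Hq-admissible 1∈Hp 1∈Hq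
         qs ps qqs≡1 pps≡1 c d vanishes =
  P.c≡0 Q.a∤k⇒c≡D , Q.c≡0 P.a∤k⇒c≡D
  where
  vanishes-swapped : (i : ℕ) → 2 ≤ i → i ≤ ⌊ q * p /2⌋ →
    Σℚ (map (λ l → d l ℚ.* Rform q p ps l i) (remove1 Hq))
      ℚ.+ Σℚ (map (λ k → c k ℚ.* Rform p q qs k i) (remove1 Hp)) ≡ 0ℚ
  vanishes-swapped i 2≤i i≤⌊qp/2⌋ =
    trans (ℚₚ.+-comm (Σℚ (map (λ l → d l ℚ.* Rform q p ps l i) (remove1 Hq)))
                     (Σℚ (map (λ k → c k ℚ.* Rform p q qs k i) (remove1 Hp))))
          (vanishes i 2≤i (subst (λ n → i ≤ ⌊ n /2⌋) (ℕₚ.*-comm q p) i≤⌊qp/2⌋))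
  module P = VanishingCombination p q p-prime q-prime p≢q 3≤p 3≤q qs ps (∣ᵤ⇒∣ qqs≡1) (∣ᵤ⇒∣ pps≡1)
                         Hp-admissible Hq-admissible 1∈Hp 1∈Hq c d vanishes
  module Q = VanishingCombination q p q-prime p-prime (p≢q ∘ sym) 3≤q 3≤p ps qs (∣ᵤ⇒∣ pps≡1) (∣ᵤ⇒∣ qqs≡1)
                         Hq-admissible Hp-admissible 1∈Hq 1∈Hp d c vanishes-swapped
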